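{- There is a transversal matroid of rank $4$ which is not balanced.
   Context: For a matroid $\mathcal{M}$ on a finite set $E$ and disjoint $I,J\subseteq E$, let $M_I^J$ denote the number of bases $B$ of $\mathcal{M}$ with $I\subseteq B$ and $B\cap J=\varnothing$. $\mathcal{M}$ is negatively correlated if $M_e^fM_f^e-M_{ef}M^{ef}\ge0$ for all distinct $e,f\in E$, and balanced if every minor of $\mathcal{M}$ is negatively correlated. A transversal matroid is one whose independent sets are the partial transversals of some finite family of subsets of its ground set. -}

module Defs where

open import Data.Nat using (ℕ; _*_; _≤_; _<_)
open import Data.Fin using (Fin)
open import Data.Fin.Subset
  using (Subset; _∈_; _∉_; _⊆_; _∪_; _∩_; ∣_∣; ⁅_⁆; ∁; Empty)
  renaming (⊥ to ∅; ⊤ to Full)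
open import Data.List using (List; length)
import Data.List.Membership.Propositional as LM
open import Data.List.Relation.Unary.Unique.Propositional using (Unique)
open import Data.Product using (Σ; ∃; _×_; _,_)
open import Relation.Binary.PropositionalEquality using (_≡_; _≢_)
open import Relation.Nullary using (¬_)
open import Function.Bundles using (_⇔_)

record Matroid (n : ℕ) : Set₁ where
  field
    Indep      : Subset n → Set
    indep-∅    : Indep ∅
    indep-⊆    : ∀ {I J} → Indep J → I ⊆ J → Indep I
    indep-aug  : ∀ {I J} → Indep I → Indep J → ∣ I ∣ < ∣ J ∣ →
                 ∃ λ x → x ∈ J × x ∉ I × Indep (⁅ x ⁆ ∪ I)
open Matroid public

MaxIn : {n : ℕ} → (Subset n → Set) → Subset n → Subset n → Set
MaxIn P G B = B ⊆ G × P B × (∀ X → B ⊆ X → X ⊆ G → P X → X ⊆ B)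

PartialTransversal : {n m : ℕ} → (Fin m → Subset n) → Subset n → Set
PartialTransversal {n} {m} A I =
  Σ ((x : Fin n) → x ∈ I → Fin m) λ f →
    (∀ x y (p : x ∈ I) (q : y ∈ I) → f x p ≡ f y q → x ≡ y) ×
    (∀ x (p : x ∈ I) → x ∈ A (f x p))

IsTransversal : {n : ℕ} → Matroid n → Set
IsTransversal {n} M =
  Σ ℕ λ m → Σ (Fin m → Subset n) λ A → ∀ I → Indep M I ⇔ PartialTransversal A I

IsBasis : {n : ℕ} → Matroid n → Subset n → Set
IsBasis M B = MaxIn (Indep M) Full B

HasRank : {n : ℕ} → Matroid n → ℕ → Set
HasRank M r = Σ _ λ B → IsBasis M B × ∣ B ∣ ≡ r

Count : {n : ℕ} → (Subset n → Set) → ℕ → Set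
Count {n} P k = Σ (List (Subset n)) λ xs →
  Unique xs × (∀ X → (X LM.∈ xs) ⇔ P X) × length xs ≡ k

-- Independent sets of the minor M / C \ D (ground set E ∖ (C ∪ D)):
-- I avoids C ∪ D and I ∪ B_C is independent in M for a basis B_C of M|C.
MinorIndep : {n : ℕ} → Matroid n → Subset n → Subset n → Subset n → Set
MinorIndep M C D I =
  I ⊆ ∁ (C ∪ D) × Σ _ λ BC → MaxIn (Indep M) C BC × Indep M (I ∪ BC)

MinorBasis : {n : ℕ} → Matroid n → Subset n → Subset n → Subset n → Set
MinorBasis M C D B = MaxIn (MinorIndep M C D) (∁ (C ∪ D)) B

NegCorrelated : {n : ℕ} → (Subset n → Set) → Subset n → Set
NegCorrelated Bs G =
  ∀ e f → e ∈ G → f ∈ G → e ≢ f → ∀ a b c d →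
  Count (λ B → Bs B × e ∈ B × f ∉ B) a →
  Count (λ B → Bs B × f ∈ B × e ∉ B) b →
  Count (λ B → Bs B × e ∈ B × f ∈ B) c →
  Count (λ B → Bs B × e ∉ B × f ∉ B) d →
  c * d ≤ a * b

Balanced : {n : ℕ} → Matroid n → Set
Balanced M = ∀ C D → Empty (C ∩ D) →
  NegCorrelated (MinorBasis M C D) (∁ (C ∪ D))

module Submission where

-- M is the transversal matroid of the family A₀, A₁, A₂, A₃ of subsets of {0, …, 10}
-- defined below; it has rank 4. For e = 9 (in A₀, A₁, A₂) and f = 10 (only in A₃), the
-- trivial minor M itself is not negatively correlated: M_ef · M^ef = 27 · 81 exceeds
-- M_e^f · M_f^e = 80 · 27.
-- Rather than proving that partial transversals of an arbitrary family satisfy the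
-- augmentation axiom, it is verified for this family: for every partial transversal I with
-- |I| < 4, no (|I| + 1)-set disjoint from the one-element extensions of I is a partial
-- transversal. Partial transversals are decided by matching elements to unused sets one
-- at a time.

open import Defs
open import Data.Nat using (ℕ; zero; suc; pred; _≤_; _<_; _*_; z≤n; s≤s; _≟_; _≤?_)
open import Data.Nat.Properties using (≤-<-trans; ≤-trans; ≤-antisym; <⇒≱; ≰⇒>)
open import Data.Bool using (true; false)
open import Data.Fin using (Fin; zero; suc; #_)
import Data.Fin.Properties as Fin
open import Data.Fin.Subset
  using (Subset; _∈_; _∉_; _⊆_; _∪_; _-_; ∣_∣; ⁅_⁆; ⋃; ∁)
  renaming (⊥ to ∅; ⊤ to Full)
open import Data.Fin.Subset.Properties
open import Data.Vec using ([]; _∷_; here; there; tail; tabulate)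
open import Data.Vec.Properties using (∷-injectiveʳ; []=⇒lookup; lookup∘tabulate)
open import Data.List using (List; []; _∷_; _++_; map; filter; length)
import Data.List.Membership.Propositional as List
open import Data.List.Membership.Propositional.Properties
import Data.List.Relation.Unary.Any as Any
import Data.List.Relation.Unary.All as All
open import Data.List.Relation.Unary.All using (All)
open import Data.List.Relation.Unary.Unique.Propositional using (Unique; []; _∷_)
import Data.List.Relation.Unary.Unique.Propositional.Properties as Unique
open import Data.Product using (Σ; ∃; _×_; _,_; proj₁; proj₂)
open import Data.Sum using (inj₁; inj₂)
open import Function using (_∘_)
open import Function.Bundles using (_⇔_; mk⇔; Equivalence)
import Function.Properties.Equivalence as ⇔
open import Relation.Binary.PropositionalEquality
open import Relation.Nullary using (¬_; Dec; yes; no; does; contradiction; ¬?)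
open import Relation.Nullary.Decidable as Dec using (_×-dec_; _→-dec_; from-yes; from-no)
open import Relation.Unary using (Pred; Decidable)

injective⇒∣p∣≤∣q∣ : ∀ {n m} (p : Subset n) (q : Subset m) (f : ∀ x → x ∈ p → Fin m) →
  (∀ x x∈p → f x x∈p ∈ q) → (∀ x y x∈p y∈p → f x x∈p ≡ f y y∈p → x ≡ y) →
  ∣ p ∣ ≤ ∣ q ∣
injective⇒∣p∣≤∣q∣ [] q f f∈q inj = z≤n
injective⇒∣p∣≤∣q∣ (false ∷ p) q f f∈q inj =
  injective⇒∣p∣≤∣q∣ p q (λ x x∈p → f (suc x) (there x∈p))
    (λ x x∈p → f∈q (suc x) (there x∈p))
    (λ x y x∈p y∈p eq → Fin.suc-injective (inj _ _ _ _ eq))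
injective⇒∣p∣≤∣q∣ (true ∷ p) q f f∈q inj =
  ≤-<-trans (injective⇒∣p∣≤∣q∣ p (q - f zero here) g g∈q-f₀ g-injective)
            (x∈p⇒∣p-x∣<∣p∣ (f∈q zero here))
  where
  g : ∀ x → x ∈ p → Fin _
  g x x∈p = f (suc x) (there x∈p)
  g∈q-f₀ : ∀ x x∈p → g x x∈p ∈ q - f zero here
  g∈q-f₀ x x∈p = x∈p∧x≢y⇒x∈p-y (f∈q (suc x) (there x∈p)) (λ eq → Fin.0≢1+n (sym (inj _ _ _ _ eq)))
  g-injective : ∀ x y x∈p y∈p → g x x∈p ≡ g y y∈p → x ≡ y
  g-injective x y x∈p y∈p eq = Fin.suc-injective (inj _ _ _ _ eq)

p⊆q⇒∣q∣≤∣p∣⇒q⊆p : ∀ {n} {p q : Subset n} → p ⊆ q → ∣ q ∣ ≤ ∣ p ∣ → q ⊆ p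
p⊆q⇒∣q∣≤∣p∣⇒q⊆p {p = p} p⊆q ∣q∣≤∣p∣ {x} x∈q with x ∈? p
... | yes x∈p = x∈p
... | no  x∉p = contradiction ∣q∣≤∣p∣ (<⇒≱ (p⊂q⇒∣p∣<∣q∣ (p⊆q , x , x∈q , x∉p)))

subset-of-size : ∀ {n} (p : Subset n) k → k ≤ ∣ p ∣ → ∃ λ q → q ⊆ p × ∣ q ∣ ≡ k
subset-of-size [] zero _ = [] , ⊆-refl , refl
subset-of-size (false ∷ p) k k≤∣p∣ with subset-of-size p k k≤∣p∣
... | q , q⊆p , ∣q∣≡k = false ∷ q , out⊆ q⊆p , ∣q∣≡k
subset-of-size {suc n} (true ∷ p) zero _ = ∅ , ⊥⊆ , ∣⊥∣≡0 (suc n)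
subset-of-size (true ∷ p) (suc k) (s≤s k≤∣p∣) with subset-of-size p k k≤∣p∣
... | q , q⊆p , ∣q∣≡k = true ∷ q , s⊆s q⊆p , cong suc ∣q∣≡k

subsetsOfSize : ∀ {n} → Subset n → ℕ → List (Subset n)
subsetsOfSize []          zero    = [] ∷ []
subsetsOfSize []          (suc k) = []
subsetsOfSize (false ∷ p) k       = map (false ∷_) (subsetsOfSize p k)
subsetsOfSize (true ∷ p)  zero    = map (false ∷_) (subsetsOfSize p zero)
subsetsOfSize (true ∷ p)  (suc k) =
  map (false ∷_) (subsetsOfSize p (suc k)) ++ map (true ∷_) (subsetsOfSize p k)

∈-subsetsOfSize⁺ : ∀ {n} {p q : Subset n} {k} → q ⊆ p → ∣ q ∣ ≡ k → q List.∈ subsetsOfSize p k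
∈-subsetsOfSize⁺ {p = []}        {[]}               _   refl = Any.here refl
∈-subsetsOfSize⁺ {p = false ∷ p} {false ∷ q}        q⊆p ∣q∣≡k =
  ∈-map⁺ (false ∷_) (∈-subsetsOfSize⁺ (drop-∷-⊆ q⊆p) ∣q∣≡k)
∈-subsetsOfSize⁺ {p = false ∷ p} {true ∷ q}         q⊆p _ with q⊆p here
... | ()
∈-subsetsOfSize⁺ {p = true ∷ p}  {false ∷ q} {zero}  q⊆p ∣q∣≡k =
  ∈-map⁺ (false ∷_) (∈-subsetsOfSize⁺ (drop-∷-⊆ q⊆p) ∣q∣≡k)
∈-subsetsOfSize⁺ {p = true ∷ p}  {false ∷ q} {suc k} q⊆p ∣q∣≡k =
  ∈-++⁺ˡ (∈-map⁺ (false ∷_) (∈-subsetsOfSize⁺ (drop-∷-⊆ q⊆p) ∣q∣≡k))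
∈-subsetsOfSize⁺ {p = true ∷ p}  {true ∷ q}  {suc k} q⊆p ∣q∣≡k =
  ∈-++⁺ʳ (map (false ∷_) (subsetsOfSize p (suc k)))
         (∈-map⁺ (true ∷_) (∈-subsetsOfSize⁺ (drop-∷-⊆ q⊆p) (cong pred ∣q∣≡k)))

subsetsOfSize-unique : ∀ {n} (p : Subset n) k → Unique (subsetsOfSize p k)
subsetsOfSize-unique []          zero    = All.[] ∷ []
subsetsOfSize-unique []          (suc k) = []
subsetsOfSize-unique (false ∷ p) k       = Unique.map⁺ ∷-injectiveʳ (subsetsOfSize-unique p k)
subsetsOfSize-unique (true ∷ p)  zero    = Unique.map⁺ ∷-injectiveʳ (subsetsOfSize-unique p zero)
subsetsOfSize-unique (true ∷ p)  (suc k) =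
  Unique.++⁺ (Unique.map⁺ ∷-injectiveʳ (subsetsOfSize-unique p (suc k)))
             (Unique.map⁺ ∷-injectiveʳ (subsetsOfSize-unique p k))
             heads-differ
  where
  heads-differ : ∀ {q} → ¬ (q List.∈ map (false ∷_) (subsetsOfSize p (suc k)) ×
                          q List.∈ map (true ∷_) (subsetsOfSize p k))
  heads-differ (q∈₁ , q∈₂) with ∈-map⁻ (false ∷_) q∈₁ | ∈-map⁻ (true ∷_) q∈₂
  ... | _ , _ , refl | _ , _ , ()

fromDec : ∀ {n p} {P : Pred (Fin n) p} → Decidable P → Subset n
fromDec P? = tabulate (does ∘ P?)

∈-fromDec⁻ : ∀ {n p} {P : Pred (Fin n) p} (P? : Decidable P) {x} → x ∈ fromDec P? → P x
∈-fromDec⁻ P? {x} x∈ with P? x | trans (sym (lookup∘tabulate (does ∘ P?) x)) ([]=⇒lookup x∈)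
... | yes Px | _ = Px
... | no  _  | ()

count-filter : ∀ {n} {P : Subset n → Set} (P? : Decidable P) (xs : List (Subset n)) →
  Unique xs → (∀ {X} → P X → X List.∈ xs) → Count P (length (filter P? xs))
count-filter P? xs xs-unique P⊆xs =
  filter P? xs , Unique.filter⁺ P? xs-unique ,
  (λ X → mk⇔ (proj₂ ∘ ∈-filter⁻ P? {xs = xs}) (λ PX → ∈-filter⁺ P? (P⊆xs PX) PX)) , refl

augment-from-extensions : ∀ {n} {P : Subset n → Set} → (∀ {I J} → P J → I ⊆ J → P I) →
  ∀ {I J} (E : Subset n) → (∀ {x} → x ∈ E → x ∉ I × P (⁅ x ⁆ ∪ I)) →
  (∀ {K} → K ⊆ ∁ E → ∣ K ∣ ≡ suc ∣ I ∣ → ¬ P K) →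
  P J → ∣ I ∣ < ∣ J ∣ → ∃ λ x → x ∈ J × x ∉ I × P (⁅ x ⁆ ∪ I)
augment-from-extensions P-⊆ {J = J} E extends blocked PJ ∣I∣<∣J∣
  with subset-of-size J _ ∣I∣<∣J∣
... | K , K⊆J , ∣K∣≡ with Fin.any? (λ x → (x ∈? K) ×-dec (x ∈? E))
...   | yes (x , x∈K , x∈E) = x , K⊆J x∈K , extends x∈E
...   | no  K∩E-empty =
  contradiction (P-⊆ PJ K⊆J)
    (blocked (λ x∈K → x∉p⇒x∈∁p (λ x∈E → K∩E-empty (_ , x∈K , x∈E))) ∣K∣≡)

MaxIn-cong : ∀ {n} {P Q : Subset n → Set} {G B} → (∀ {X} → P X ⇔ Q X) →
  MaxIn P G B ⇔ MaxIn Q G B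
MaxIn-cong P⇔Q = mk⇔
  (λ (B⊆G , PB , max) → B⊆G , to P⇔Q PB , λ X B⊆X X⊆G QX → max X B⊆X X⊆G (from P⇔Q QX))
  (λ (B⊆G , QB , max) → B⊆G , from P⇔Q QB , λ X B⊆X X⊆G PX → max X B⊆X X⊆G (to P⇔Q PX))
  where open Equivalence

∁[∅∪∅]≡Full : ∀ {n} → ∁ (∅ ∪ ∅) ≡ Full {n}
∁[∅∪∅]≡Full {zero}  = refl
∁[∅∪∅]≡Full {suc n} = cong (true ∷_) ∁[∅∪∅]≡Full

module _ {n} (M : Matroid n) where

  minorIndep-∅-∅⇔indep : ∀ {I} → MinorIndep M ∅ ∅ I ⇔ Indep M I
  minorIndep-∅-∅⇔indep {I} = mk⇔
    (λ (_ , C , _ , I∪C-indep) → indep-⊆ M I∪C-indep (p⊆p∪q C))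
    (λ I-indep → (λ {_} _ → subst (_ ∈_) (sym ∁[∅∪∅]≡Full) ∈⊤) , ∅ , ∅-basis-of-∅ ,
                 subst (Indep M) (sym (∪-identityʳ I)) I-indep)
    where
    ∅-basis-of-∅ : MaxIn (Indep M) ∅ ∅
    ∅-basis-of-∅ = ⊆-refl , indep-∅ M , λ _ _ X⊆∅ _ → X⊆∅

  minorBasis-∅-∅⇔basis : ∀ {B} → MinorBasis M ∅ ∅ B ⇔ IsBasis M B
  minorBasis-∅-∅⇔basis {B} =
    subst (λ G → MaxIn (MinorIndep M ∅ ∅) G B ⇔ IsBasis M B) (sym ∁[∅∪∅]≡Full)
      (MaxIn-cong minorIndep-∅-∅⇔indep)

  indep-of-maximum-size⇒basis : ∀ {B} → Indep M B → (∀ {I} → Indep M I → ∣ I ∣ ≤ ∣ B ∣) →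
    IsBasis M B
  indep-of-maximum-size⇒basis B-indep maximum =
    ⊆⊤ , B-indep , λ _ B⊆X _ X-indep → p⊆q⇒∣q∣≤∣p∣⇒q⊆p B⊆X (maximum X-indep)

  basis-maximum : ∀ {B I} → IsBasis M B → Indep M I → ∣ I ∣ ≤ ∣ B ∣
  basis-maximum {B} {I} (_ , B-indep , B-maximal) I-indep with ∣ I ∣ ≤? ∣ B ∣
  ... | yes ∣I∣≤∣B∣ = ∣I∣≤∣B∣
  ... | no  ∣I∣≰∣B∣ with indep-aug M B-indep I-indep (≰⇒> ∣I∣≰∣B∣)
  ...   | x , _ , x∉B , x∪B-indep =
    contradiction (B-maximal _ (q⊆p∪q ⁅ x ⁆ B) ⊆⊤ x∪B-indep (x∈p∪q⁺ (inj₁ (x∈⁅x⁆ x)))) x∉B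

  basis⇔indep-of-rank : ∀ {B X} → IsBasis M B → IsBasis M X ⇔ (Indep M X × ∣ X ∣ ≡ ∣ B ∣)
  basis⇔indep-of-rank B-basis@(_ , B-indep , _) = mk⇔
    (λ X-basis@(_ , X-indep , _) →
       X-indep , ≤-antisym (basis-maximum B-basis X-indep) (basis-maximum X-basis B-indep))
    (λ (X-indep , ∣X∣≡∣B∣) → indep-of-maximum-size⇒basis X-indep
       (λ I-indep → subst (_ ≤_) (sym ∣X∣≡∣B∣) (basis-maximum B-basis I-indep)))

module _ {n m} (A : Fin m → Subset n) where

  partialTransversal-⊆ : ∀ {I J} → PartialTransversal A J → I ⊆ J → PartialTransversal A I
  partialTransversal-⊆ (f , f-injective , f∈A) I⊆J =
    (λ x x∈I → f x (I⊆J x∈I)) , (λ x y x∈I y∈I → f-injective x y (I⊆J x∈I) (I⊆J y∈I)) ,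
    (λ x x∈I → f∈A x (I⊆J x∈I))

  partialTransversal-∅ : PartialTransversal A ∅
  partialTransversal-∅ =
    (λ _ x∈∅ → contradiction x∈∅ ∉⊥) , (λ _ _ x∈∅ → contradiction x∈∅ ∉⊥) ,
    (λ _ x∈∅ → contradiction x∈∅ ∉⊥)

  partialTransversal-∣∣≤ : ∀ {I} → PartialTransversal A I → ∣ I ∣ ≤ m
  partialTransversal-∣∣≤ {I} (f , f-injective , _) =
    subst (∣ I ∣ ≤_) (∣⊤∣≡n m) (injective⇒∣p∣≤∣q∣ I Full f (λ _ _ → ∈⊤) f-injective)

AvoidingTransversal : ∀ {n m} → (Fin m → Subset n) → Subset m → Subset n → Set
AvoidingTransversal A U I =
  Σ (PartialTransversal A I) λ (f , _) → ∀ x x∈I → f x x∈I ∉ U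

∈-tail⁺ : ∀ {n} {p : Subset (suc n)} {x} → suc x ∈ p → x ∈ tail p
∈-tail⁺ {p = _ ∷ _} (there x∈p) = x∈p

∈-tail⁻ : ∀ {n} {p : Subset (suc n)} {x} → x ∈ tail p → suc x ∈ p
∈-tail⁻ {p = _ ∷ _} x∈p = there x∈p

module _ {n m} {A : Fin m → Subset (suc n)} {U : Subset m} where

  avoidingTransversal-outside :
    ∀ {I} → AvoidingTransversal (tail ∘ A) U I ⇔ AvoidingTransversal A U (false ∷ I)
  avoidingTransversal-outside = mk⇔
    (λ ((g , g-injective , g∈A) , g∉U) →
       ( (λ { (suc x) x∈I → g x (drop-there x∈I) })
       , (λ { (suc x) (suc y) x∈I y∈I eq → cong suc (g-injective x y _ _ eq) })
       , (λ { (suc x) x∈I → ∈-tail⁻ (g∈A x (drop-there x∈I)) }) )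
       , (λ { (suc x) x∈I → g∉U x (drop-there x∈I) }))
    (λ ((f , f-injective , f∈A) , f∉U) →
       ( (λ x x∈I → f (suc x) (there x∈I))
       , (λ x y x∈I y∈I eq → Fin.suc-injective (f-injective _ _ _ _ eq))
       , (λ x x∈I → ∈-tail⁺ (f∈A (suc x) (there x∈I))) )
       , (λ x x∈I → f∉U (suc x) (there x∈I)))

  avoidingTransversal-inside : ∀ {I} →
    (∃ λ j → j ∉ U × zero ∈ A j × AvoidingTransversal (tail ∘ A) (⁅ j ⁆ ∪ U) I) ⇔
    AvoidingTransversal A U (true ∷ I)
  avoidingTransversal-inside {I} = mk⇔ extend restrict
    where
    extend : (∃ λ j → j ∉ U × zero ∈ A j × AvoidingTransversal (tail ∘ A) (⁅ j ⁆ ∪ U) I) →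
             AvoidingTransversal A U (true ∷ I)
    extend (j , j∉U , 0∈Aj , (g , g-injective , g∈A) , g∉j∪U) = (f , f-injective , f∈A) , f∉U
      where
      g≢j : ∀ x x∈I → g x x∈I ≢ j
      g≢j x x∈I eq = g∉j∪U x x∈I (x∈p∪q⁺ (inj₁ (subst (_∈ ⁅ j ⁆) (sym eq) (x∈⁅x⁆ j))))
      f : ∀ x → x ∈ true ∷ I → Fin m
      f zero    _    = j
      f (suc x) x∈tI = g x (drop-there x∈tI)
      f-injective : ∀ x y x∈ y∈ → f x x∈ ≡ f y y∈ → x ≡ y
      f-injective zero    zero    _  _  _  = refl
      f-injective zero    (suc y) _  y∈ eq = contradiction (sym eq) (g≢j y (drop-there y∈))
      f-injective (suc x) zero    x∈ _  eq = contradiction eq (g≢j x (drop-there x∈))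
      f-injective (suc x) (suc y) _  _  eq = cong suc (g-injective x y _ _ eq)
      f∈A : ∀ x x∈ → x ∈ A (f x x∈)
      f∈A zero    _  = 0∈Aj
      f∈A (suc x) x∈ = ∈-tail⁻ (g∈A x (drop-there x∈))
      f∉U : ∀ x x∈ → f x x∈ ∉ U
      f∉U zero    _  = j∉U
      f∉U (suc x) x∈ = g∉j∪U x (drop-there x∈) ∘ x∈p∪q⁺ ∘ inj₂
    restrict : AvoidingTransversal A U (true ∷ I) →
               ∃ λ j → j ∉ U × zero ∈ A j × AvoidingTransversal (tail ∘ A) (⁅ j ⁆ ∪ U) I
    restrict ((f , f-injective , f∈A) , f∉U) =
      f zero here , f∉U zero here , f∈A zero here ,
      ( (λ x x∈I → f (suc x) (there x∈I))
      , (λ x y x∈I y∈I eq → Fin.suc-injective (f-injective _ _ _ _ eq))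
      , (λ x x∈I → ∈-tail⁺ (f∈A (suc x) (there x∈I))) ) ,
      λ x x∈I fx∈j∪U → case-∪ x x∈I (x∈p∪q⁻ ⁅ f zero here ⁆ U fx∈j∪U)
      where
      case-∪ : ∀ x x∈I → _ → _
      case-∪ x x∈I (inj₁ fx∈j) =
        Fin.0≢1+n (sym (f-injective (suc x) zero (there x∈I) here (x∈⁅y⁆⇒x≡y _ fx∈j)))
      case-∪ x x∈I (inj₂ fx∈U) = f∉U (suc x) (there x∈I) fx∈U

avoidingTransversal? : ∀ {n m} (A : Fin m → Subset n) U → Decidable (AvoidingTransversal A U)
avoidingTransversal? A U [] = yes (((λ ()) , (λ ()) , (λ ())) , (λ ()))
avoidingTransversal? A U (false ∷ I) =
  Dec.map (avoidingTransversal-outside {A = A}) (avoidingTransversal? (tail ∘ A) U I)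
avoidingTransversal? A U (true ∷ I) =
  Dec.map (avoidingTransversal-inside {A = A})
    (Fin.any? λ j → ¬? (j ∈? U) ×-dec (zero ∈? A j) ×-dec
                    avoidingTransversal? (tail ∘ A) (⁅ j ⁆ ∪ U) I)

partialTransversal? : ∀ {n m} (A : Fin m → Subset n) → Decidable (PartialTransversal A)
partialTransversal? A I =
  Dec.map (mk⇔ proj₁ (λ t → t , λ _ _ → ∉⊥)) (avoidingTransversal? A ∅ I)

family : Fin 4 → Subset 11
family zero                   = ⋃ (map ⁅_⁆ (# 0 ∷ # 3 ∷ # 4 ∷ # 9 ∷ []))
family (suc zero)             = ⋃ (map ⁅_⁆ (# 1 ∷ # 5 ∷ # 6 ∷ # 9 ∷ []))
family (suc (suc zero))       = ⋃ (map ⁅_⁆ (# 2 ∷ # 7 ∷ # 8 ∷ # 9 ∷ []))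
family (suc (suc (suc zero))) = ⋃ (map ⁅_⁆ (# 3 ∷ # 4 ∷ # 5 ∷ # 6 ∷ # 7 ∷ # 8 ∷ # 10 ∷ []))

PT : Subset 11 → Set
PT = PartialTransversal family

PT? : Decidable PT
PT? = partialTransversal? family

extensions : Subset 11 → Subset 11
extensions I = fromDec (λ x → ¬? (x ∈? I) ×-dec PT? (⁅ x ⁆ ∪ I))

ExtensionsBlock : ℕ → Subset 11 → Set
ExtensionsBlock k I = PT I → All (¬_ ∘ PT) (subsetsOfSize (∁ (extensions I)) (suc k))

extensionsBlock? : ∀ k → Dec (All (ExtensionsBlock k) (subsetsOfSize Full k))
extensionsBlock? k = All.all?
  (λ I → PT? I →-dec All.all? (¬? ∘ PT?) (subsetsOfSize (∁ (extensions I)) (suc k)))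
  (subsetsOfSize Full k)

extensionsBlock : ∀ k → k < 4 → All (ExtensionsBlock k) (subsetsOfSize Full k)
extensionsBlock 0 _ = from-yes (extensionsBlock? 0)
extensionsBlock 1 _ = from-yes (extensionsBlock? 1)
extensionsBlock 2 _ = from-yes (extensionsBlock? 2)
extensionsBlock 3 _ = from-yes (extensionsBlock? 3)
extensionsBlock (suc (suc (suc (suc _)))) (s≤s (s≤s (s≤s (s≤s ()))))

PT-augment : ∀ {I J} → PT I → PT J → ∣ I ∣ < ∣ J ∣ → ∃ λ x → x ∈ J × x ∉ I × PT (⁅ x ⁆ ∪ I)
PT-augment {I} PT-I PT-J ∣I∣<∣J∣ =
  augment-from-extensions (partialTransversal-⊆ family) (extensions I)
    (∈-fromDec⁻ (λ x → ¬? (x ∈? I) ×-dec PT? (⁅ x ⁆ ∪ I))) blocked PT-J ∣I∣<∣J∣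
  where
  blocked : ∀ {K} → K ⊆ ∁ (extensions I) → ∣ K ∣ ≡ suc ∣ I ∣ → ¬ PT K
  blocked K⊆ ∣K∣≡ =
    All.lookup (All.lookup (extensionsBlock ∣ I ∣ (≤-trans ∣I∣<∣J∣ (partialTransversal-∣∣≤ family PT-J)))
                           (∈-subsetsOfSize⁺ ⊆⊤ refl) PT-I)
               (∈-subsetsOfSize⁺ K⊆ ∣K∣≡)

M : Matroid 11
M = record
  { Indep     = PT
  ; indep-∅   = partialTransversal-∅ family
  ; indep-⊆   = partialTransversal-⊆ family
  ; indep-aug = PT-augment
  }

M-transversal : IsTransversal M
M-transversal = 4 , family , λ _ → ⇔.refl

B₀ : Subset 11
B₀ = ⋃ (map ⁅_⁆ (# 0 ∷ # 1 ∷ # 2 ∷ # 10 ∷ []))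

B₀-basis : IsBasis M B₀
B₀-basis = indep-of-maximum-size⇒basis M (from-yes (PT? B₀)) (partialTransversal-∣∣≤ family)

M-rank-4 : HasRank M 4
M-rank-4 = B₀ , B₀-basis , refl

basis⇔PT-of-size-4 : ∀ {B} → MinorBasis M ∅ ∅ B ⇔ (PT B × ∣ B ∣ ≡ 4)
basis⇔PT-of-size-4 = ⇔.trans (minorBasis-∅-∅⇔basis M) (basis⇔indep-of-rank M B₀-basis)

basis? : Decidable (MinorBasis M ∅ ∅)
basis? B = Dec.map (⇔.sym basis⇔PT-of-size-4) (PT? B ×-dec (∣ B ∣ ≟ 4))

count-bases : ∀ {R : Subset 11 → Set} (R? : Decidable R) →
  Count (λ B → MinorBasis M ∅ ∅ B × R B)
        (length (filter (λ B → basis? B ×-dec R? B) (subsetsOfSize Full 4)))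
count-bases R? =
  count-filter (λ B → basis? B ×-dec R? B) (subsetsOfSize Full 4) (subsetsOfSize-unique Full 4)
    (λ (B-basis , _) → ∈-subsetsOfSize⁺ ⊆⊤ (proj₂ (Equivalence.to basis⇔PT-of-size-4 B-basis)))

e f : Fin 11
e = # 9
f = # 10

M-unbalanced : ¬ Balanced M
M-unbalanced balanced = from-no (27 * 81 ≤? 80 * 27)
  (balanced ∅ ∅ (λ (_ , x∈∅) → ∉⊥ x∈∅) e f ∈⊤ ∈⊤ (λ ()) 80 27 27 81
    (count-bases (λ B → (e ∈? B) ×-dec ¬? (f ∈? B)))
    (count-bases (λ B → (f ∈? B) ×-dec ¬? (e ∈? B)))
    (count-bases (λ B → (e ∈? B) ×-dec (f ∈? B)))
    (count-bases (λ B → ¬? (e ∈? B) ×-dec ¬? (f ∈? B))))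

proposition5p9 : Σ ℕ λ n → Σ (Matroid n) λ M →
    IsTransversal M × HasRank M 4 × ¬ Balanced M
proposition5p9 = 11 , M , M-transversal , M-rank-4 , M-unbalanced
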